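{- Let $\varphi$ be a $\mathrm{D}$-formula. For any two $\varphi$-atoms $A_1,A_2$ there exists exactly one $\varphi$-atom $A_3$ such that $A_1A_2\Rightarrow A_3$.
   Context: Formulas: $\varphi ::= p\mid\neg\varphi\mid\varphi\vee\varphi\mid\langle D\rangle\varphi$, $p\in\mathcal{AP}$; $[D]\psi:=\neg\langle D\rangle\neg\psi$. $\mathrm{CL}(\varphi)$: subformulas and their negations, identifying $\neg\neg\psi$ with $\psi$ and $\neg\langle D\rangle\psi$ with $[D]\neg\psi$. A $\varphi$-atom is $A\subseteq\mathrm{CL}(\varphi)$ with $\psi\in A$ iff $\neg\psi\notin A$, and $\psi_1\vee\psi_2\in A$ iff $\psi_1\in A$ or $\psi_2\in A$ (for formulas in $\mathrm{CL}(\varphi)$). $\mathcal{R}eq_D(A)=\{\psi:\langle D\rangle\psi\in A\}$, $\mathrm{REQ}_\varphi=\{\psi:\langle D\rangle\psi\in\mathrm{CL}(\varphi)\}$, $\mathcal{O}bs_D(A)=A\cap\mathrm{REQ}_\varphi$. $A_1A_2\Rightarrow A_3$ ($A_3$ is $D_\varphi$-generated by $A_1,A_2$) iff $A_3\cap\mathcal{AP}=A_1\cap A_2\cap\mathcal{AP}$ and $\mathcal{R}eq_D(A_3)=\mathcal{R}eq_D(A_1)\cup\mathcal{R}eq_D(A_2)\cup\mathcal{O}bs_D(A_1)\cup\mathcal{O}bs_D(A_2)$. -}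

module Defs where

open import Data.Nat using (ℕ)
open import Data.Bool using (Bool; true; false)
open import Data.Product using (Σ; _×_; _,_)
open import Data.Sum using (_⊎_)
open import Relation.Binary.PropositionalEquality using (_≡_)
open import Function.Bundles using (_⇔_)

data Formula : Set where
  prop : ℕ → Formula
  ¬_   : Formula → Formula
  _∨_  : Formula → Formula → Formula
  ⟨D⟩_ : Formula → Formula

infix 30 ¬_ ⟨D⟩_
infixl 20 _∨_

[D]_ : Formula → Formula
[D] ψ = ¬ (⟨D⟩ (¬ ψ))

-- Negation modulo the identification ¬¬ψ = ψ.
-- (The identification ¬⟨D⟩ψ = [D]¬ψ = ¬⟨D⟩¬¬ψ is then automatic.)
neg : Formula → Formula
neg (¬ ψ) = ψ
neg ψ     = ¬ ψ

nf : Formula → Formula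
nf (prop p)  = prop p
nf (¬ ψ)     = neg (nf ψ)
nf (ψ ∨ χ)   = nf ψ ∨ nf χ
nf (⟨D⟩ ψ)   = ⟨D⟩ (nf ψ)

data _≼_ : Formula → Formula → Set where
  here  : ∀ {ψ} → ψ ≼ ψ
  inNeg : ∀ {ψ χ} → ψ ≼ χ → ψ ≼ (¬ χ)
  inOrL : ∀ {ψ χ₁ χ₂} → ψ ≼ χ₁ → ψ ≼ (χ₁ ∨ χ₂)
  inOrR : ∀ {ψ χ₁ χ₂} → ψ ≼ χ₂ → ψ ≼ (χ₁ ∨ χ₂)
  inDia : ∀ {ψ χ} → ψ ≼ χ → ψ ≼ (⟨D⟩ χ)

_∈CL_ : Formula → Formula → Set
ψ ∈CL φ = (ψ ≼ nf φ) ⊎ Σ Formula (λ χ → (χ ≼ nf φ) × (ψ ≡ neg χ))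

FSet : Set
FSet = Formula → Bool

_∈_ : Formula → FSet → Set
ψ ∈ A = A ψ ≡ true

_∉_ : Formula → FSet → Set
ψ ∉ A = A ψ ≡ false

record IsAtom (φ : Formula) (A : FSet) : Set where
  field
    sub   : ∀ ψ → ψ ∈ A → ψ ∈CL φ
    compl : ∀ ψ → ψ ∈CL φ → (ψ ∈ A ⇔ neg ψ ∉ A)
    disj  : ∀ ψ₁ ψ₂ → (ψ₁ ∨ ψ₂) ∈CL φ → ((ψ₁ ∨ ψ₂) ∈ A ⇔ (ψ₁ ∈ A ⊎ ψ₂ ∈ A))

_∈Req_ : Formula → FSet → Set
ψ ∈Req A = (⟨D⟩ ψ) ∈ A

_∈REQ_ : Formula → Formula → Set
ψ ∈REQ φ = (⟨D⟩ ψ) ∈CL φ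

Obs : Formula → FSet → Formula → Set
Obs φ A ψ = ψ ∈ A × ψ ∈REQ φ

record Generated (φ : Formula) (A₁ A₂ A₃ : FSet) : Set where
  field
    props : ∀ (p : ℕ) → (prop p ∈ A₃ ⇔ (prop p ∈ A₁ × prop p ∈ A₂))
    reqs  : ∀ ψ → (ψ ∈Req A₃ ⇔ (ψ ∈Req A₁ ⊎ ψ ∈Req A₂ ⊎ Obs φ A₁ ψ ⊎ Obs φ A₂ ψ))

-- Inside a φ-atom the truth values of ¬ψ and ψ₁ ∨ ψ₂ are forced by those of ψ, ψ₁, ψ₂,
-- while nothing ties ⟨D⟩ψ to ψ. So a φ-atom is the restriction to CL(φ) of the Boolean
-- valuation that treats atomic propositions and ⟨D⟩-formulas as independent atoms, and it
-- is determined by its values on those; D_φ-generation by A₁, A₂ prescribes exactly these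
-- values, which gives both existence and uniqueness of A₃.

module Submission where

open import Defs
open import Data.Bool using (Bool; true; false; not; _∧_) renaming (_∨_ to _∨ᵇ_)
open import Data.Bool.Properties using (⇔→≡; ¬-not; not-involutive)
open import Data.Empty using (⊥-elim)
open import Data.Nat using (ℕ)
import Data.Nat.Properties as ℕ
open import Data.Product using (Σ; _×_; _,_; proj₁; proj₂; map₁; map₂)
open import Data.Sum using (_⊎_; inj₁; inj₂; [_,_])
open import Data.Sum.Function.Propositional using (_⊎-⇔_)
open import Level using (0ℓ)
open import Function using (id; const; _∘_)
open import Function.Bundles using (_⇔_; mk⇔; Equivalence)
import Function.Properties.Equivalence as ⇔
open import Relation.Binary.Definitions using (DecidableEquality)
open import Relation.Binary.PropositionalEquality using (_≡_; refl; sym; trans; cong; cong₂; subst; module ≡-Reasoning)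
open ≡-Reasoning
open import Relation.Nullary using (Dec; yes; no; map′; _⊎-dec_; _×-dec_) renaming (¬_ to Not)
open import Relation.Unary using (Pred; Decidable)

open Equivalence

_≟_ : DecidableEquality Formula
prop m ≟ prop n = map′ (cong prop) (λ { refl → refl }) (m ℕ.≟ n)
(¬ φ) ≟ (¬ ψ) = map′ (cong ¬_) (λ { refl → refl }) (φ ≟ ψ)
(φ₁ ∨ φ₂) ≟ (ψ₁ ∨ ψ₂) =
  map′ (λ { (refl , refl) → refl }) (λ { refl → refl , refl }) (φ₁ ≟ ψ₁ ×-dec φ₂ ≟ ψ₂)
(⟨D⟩ φ) ≟ (⟨D⟩ ψ) = map′ (cong ⟨D⟩_) (λ { refl → refl }) (φ ≟ ψ)
prop _ ≟ (¬ _)    = no λ ()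
prop _ ≟ (_ ∨ _)  = no λ ()
prop _ ≟ (⟨D⟩ _)  = no λ ()
(¬ _) ≟ prop _    = no λ ()
(¬ _) ≟ (_ ∨ _)   = no λ ()
(¬ _) ≟ (⟨D⟩ _)   = no λ ()
(_ ∨ _) ≟ prop _  = no λ ()
(_ ∨ _) ≟ (¬ _)   = no λ ()
(_ ∨ _) ≟ (⟨D⟩ _) = no λ ()
(⟨D⟩ _) ≟ prop _  = no λ ()
(⟨D⟩ _) ≟ (¬ _)   = no λ ()
(⟨D⟩ _) ≟ (_ ∨ _) = no λ ()

≼-trans : ∀ {φ ψ χ} → φ ≼ ψ → ψ ≼ χ → φ ≼ χ
≼-trans φ≼ψ here      = φ≼ψ
≼-trans φ≼ψ (inNeg q) = inNeg (≼-trans φ≼ψ q)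
≼-trans φ≼ψ (inOrL q) = inOrL (≼-trans φ≼ψ q)
≼-trans φ≼ψ (inOrR q) = inOrR (≼-trans φ≼ψ q)
≼-trans φ≼ψ (inDia q) = inDia (≼-trans φ≼ψ q)

∃≼ : Formula → Pred Formula 0ℓ → Set
∃≼ φ P = Σ Formula λ ψ → ψ ≼ φ × P ψ

∃≼-here : ∀ {P φ} → P φ → ∃≼ φ P
∃≼-here Pφ = _ , here , Pφ

∃≼? : ∀ {P} → Decidable P → ∀ φ → Dec (∃≼ φ P)
∃≼? P? (prop p) = map′ ∃≼-here (λ { (_ , here , Pφ) → Pφ }) (P? (prop p))
∃≼? P? (¬ φ) =
  map′ [ ∃≼-here , map₂ (map₁ inNeg) ]
       (λ { (_ , here , Pψ) → inj₁ Pψ ; (ψ , inNeg ψ≼φ , Pψ) → inj₂ (ψ , ψ≼φ , Pψ) })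
       (P? (¬ φ) ⊎-dec ∃≼? P? φ)
∃≼? P? (φ₁ ∨ φ₂) =
  map′ [ ∃≼-here , [ map₂ (map₁ inOrL) , map₂ (map₁ inOrR) ] ]
       (λ { (_ , here , Pψ)       → inj₁ Pψ
          ; (ψ , inOrL ψ≼φ₁ , Pψ) → inj₂ (inj₁ (ψ , ψ≼φ₁ , Pψ))
          ; (ψ , inOrR ψ≼φ₂ , Pψ) → inj₂ (inj₂ (ψ , ψ≼φ₂ , Pψ)) })
       (P? (φ₁ ∨ φ₂) ⊎-dec ∃≼? P? φ₁ ⊎-dec ∃≼? P? φ₂)
∃≼? P? (⟨D⟩ φ) =
  map′ [ ∃≼-here , map₂ (map₁ inDia) ]
       (λ { (_ , here , Pψ) → inj₁ Pψ ; (ψ , inDia ψ≼φ , Pψ) → inj₂ (ψ , ψ≼φ , Pψ) })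
       (P? (⟨D⟩ φ) ⊎-dec ∃≼? P? φ)

_≼?_ : ∀ ψ φ → Dec (ψ ≼ φ)
ψ ≼? φ = map′ (λ { (_ , ψ≼φ , refl) → ψ≼φ }) (λ ψ≼φ → ψ , ψ≼φ , refl) (∃≼? (ψ ≟_) φ)

_∈CL?_ : ∀ ψ φ → Dec (ψ ∈CL φ)
ψ ∈CL? φ = ψ ≼? nf φ ⊎-dec ∃≼? (λ χ → ψ ≟ neg χ) (nf φ)

∈CL-≼ : ∀ {φ ψ χ} → ψ ≼ χ → χ ∈CL φ → ψ ∈CL φ
∈CL-≼ here cl = cl
∈CL-≼ ψ≼χ (inj₁ χ≼φ) = inj₁ (≼-trans ψ≼χ χ≼φ)
∈CL-≼ ψ≼χ (inj₂ (¬ χ , ¬χ≼φ , refl)) = inj₁ (≼-trans ψ≼χ (≼-trans (inNeg here) ¬χ≼φ))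
∈CL-≼ (inNeg ψ≼χ) (inj₂ (prop _ , χ≼φ , refl)) = inj₁ (≼-trans ψ≼χ χ≼φ)
∈CL-≼ (inNeg ψ≼χ) (inj₂ (_ ∨ _ , χ≼φ , refl))  = inj₁ (≼-trans ψ≼χ χ≼φ)
∈CL-≼ (inNeg ψ≼χ) (inj₂ (⟨D⟩ _ , χ≼φ , refl)) = inj₁ (≼-trans ψ≼χ χ≼φ)

∈CL-neg : ∀ {φ ψ} → ψ ∈CL φ → neg ψ ∈CL φ
∈CL-neg (inj₁ ψ≼φ) = inj₂ (_ , ψ≼φ , refl)
∈CL-neg (inj₂ (¬ χ , ¬χ≼φ , refl))  = inj₂ (χ , ≼-trans (inNeg here) ¬χ≼φ , refl)
∈CL-neg (inj₂ (prop _ , χ≼φ , refl)) = inj₁ χ≼φ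
∈CL-neg (inj₂ (_ ∨ _ , χ≼φ , refl))  = inj₁ χ≼φ
∈CL-neg (inj₂ (⟨D⟩ _ , χ≼φ , refl)) = inj₁ χ≼φ

∧-≡-true : ∀ x {y} → x ∧ y ≡ true ⇔ (x ≡ true × y ≡ true)
∧-≡-true true  = mk⇔ (refl ,_) proj₂
∧-≡-true false = mk⇔ (λ ()) proj₁

∨-≡-true : ∀ x {y} → x ∨ᵇ y ≡ true ⇔ (x ≡ true ⊎ y ≡ true)
∨-≡-true true  = mk⇔ inj₁ (const refl)
∨-≡-true false = mk⇔ inj₂ [ (λ ()) , id ]

≡-not : ∀ {x y} → (x ≡ true ⇔ y ≡ false) → x ≡ not y
≡-not {true}  {true}  x⇔ = to x⇔ refl
≡-not {true}  {false} _  = refl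
≡-not {false} {true}  _  = refl
≡-not {false} {false} x⇔ = from x⇔ refl

module _ {φ A} (A-atom : IsAtom φ A) where
  open IsAtom A-atom

  IsAtom-∉CL : ∀ {ψ} → Not (ψ ∈CL φ) → ψ ∉ A
  IsAtom-∉CL ∉ = ¬-not (λ ψ∈A → ∉ (sub _ ψ∈A))

  IsAtom-¬ : ∀ {ψ} → (¬ ψ) ∈CL φ → A (¬ ψ) ≡ not (A ψ)
  IsAtom-¬ cl = ≡-not (compl _ cl)

  IsAtom-∨ : ∀ {ψ χ} → (ψ ∨ χ) ∈CL φ → A (ψ ∨ χ) ≡ A ψ ∨ᵇ A χ
  IsAtom-∨ cl = ⇔→≡ (⇔.trans (disj _ _ cl) (⇔.sym (∨-≡-true _)))

eval : (ℕ → Bool) → (Formula → Bool) → Formula → Bool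
eval a d (prop p) = a p
eval a d (¬ ψ)    = not (eval a d ψ)
eval a d (ψ ∨ χ)  = eval a d ψ ∨ᵇ eval a d χ
eval a d (⟨D⟩ ψ)  = d ψ

restrictCL : Formula → (Formula → Bool) → FSet
restrictCL φ v ψ with ψ ∈CL? φ
... | yes _ = v ψ
... | no _  = false

module _ (φ : Formula) {v : Formula → Bool} where

  restrictCL-∈CL : ∀ {ψ} → ψ ∈CL φ → restrictCL φ v ψ ≡ v ψ
  restrictCL-∈CL {ψ} cl with ψ ∈CL? φ
  ... | yes _ = refl
  ... | no ∉  = ⊥-elim (∉ cl)

  restrictCL-⇔ : ∀ {ψ} → ψ ∈ restrictCL φ v ⇔ (ψ ∈CL φ × v ψ ≡ true)
  restrictCL-⇔ {ψ} with ψ ∈CL? φ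
  ... | yes cl = mk⇔ (cl ,_) proj₂
  ... | no ∉   = mk⇔ (λ ()) (⊥-elim ∘ ∉ ∘ proj₁)

  restrictCL-isAtom : (∀ ψ → v (¬ ψ) ≡ not (v ψ)) → (∀ ψ χ → v (ψ ∨ χ) ≡ v ψ ∨ᵇ v χ)
                    → IsAtom φ (restrictCL φ v)
  restrictCL-isAtom v-¬ v-∨ = record
    { sub   = λ _ ψ∈ → proj₁ (to restrictCL-⇔ ψ∈)
    ; compl = λ ψ cl → subst (λ b → ψ ∈ R ⇔ b ≡ false) (sym (R-neg cl)) (true⇔not≡false (R ψ))
    ; disj  = λ ψ χ cl → subst (λ b → b ≡ true ⇔ (ψ ∈ R ⊎ χ ∈ R)) (sym (R-∨ cl)) (∨-≡-true (R ψ))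
    }
    where
    R : FSet
    R = restrictCL φ v

    true⇔not≡false : ∀ x → x ≡ true ⇔ not x ≡ false
    true⇔not≡false true  = mk⇔ (const refl) (const refl)
    true⇔not≡false false = mk⇔ (λ ()) (λ ())

    v-neg : ∀ ψ → v (neg ψ) ≡ not (v ψ)
    v-neg (¬ ψ) = begin
      v ψ               ≡⟨ not-involutive (v ψ) ⟨
      not (not (v ψ))   ≡⟨ cong not (v-¬ ψ) ⟨
      not (v (¬ ψ))     ∎
    v-neg (prop _)  = v-¬ _
    v-neg (_ ∨ _)   = v-¬ _
    v-neg (⟨D⟩ _)   = v-¬ _

    R-neg : ∀ {ψ} → ψ ∈CL φ → R (neg ψ) ≡ not (R ψ)
    R-neg {ψ} cl = begin
      R (neg ψ)    ≡⟨ restrictCL-∈CL (∈CL-neg {φ} cl) ⟩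
      v (neg ψ)    ≡⟨ v-neg ψ ⟩
      not (v ψ)    ≡⟨ cong not (restrictCL-∈CL cl) ⟨
      not (R ψ)    ∎

    R-∨ : ∀ {ψ χ} → (ψ ∨ χ) ∈CL φ → R (ψ ∨ χ) ≡ R ψ ∨ᵇ R χ
    R-∨ {ψ} {χ} cl = begin
      R (ψ ∨ χ)    ≡⟨ restrictCL-∈CL cl ⟩
      v (ψ ∨ χ)    ≡⟨ v-∨ ψ χ ⟩
      v ψ ∨ᵇ v χ   ≡⟨ cong₂ _∨ᵇ_ (restrictCL-∈CL (∈CL-≼ {φ} (inOrL here) cl))
                                  (restrictCL-∈CL (∈CL-≼ {φ} (inOrR here) cl)) ⟨
      R ψ ∨ᵇ R χ   ∎

atom-determined : ∀ {φ B a d} → IsAtom φ B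
                → (∀ p → prop p ∈CL φ → B (prop p) ≡ a p)
                → (∀ ψ → (⟨D⟩ ψ) ∈CL φ → B (⟨D⟩ ψ) ≡ d ψ)
                → ∀ ψ → B ψ ≡ restrictCL φ (eval a d) ψ
atom-determined {φ} {B} {a} {d} B-atom B-prop B-dia ψ with ψ ∈CL? φ
... | yes cl = on-CL ψ cl
  where
  on-CL : ∀ ψ → ψ ∈CL φ → B ψ ≡ eval a d ψ
  on-CL (prop p) cl = B-prop p cl
  on-CL (¬ ψ)    cl = trans (IsAtom-¬ B-atom cl) (cong not (on-CL ψ (∈CL-≼ {φ} (inNeg here) cl)))
  on-CL (ψ ∨ χ)  cl = trans (IsAtom-∨ B-atom cl)
                            (cong₂ _∨ᵇ_ (on-CL ψ (∈CL-≼ {φ} (inOrL here) cl))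
                                        (on-CL χ (∈CL-≼ {φ} (inOrR here) cl)))
  on-CL (⟨D⟩ ψ)  cl = B-dia ψ cl
... | no ∉ = IsAtom-∉CL B-atom ∉

generatedProp : FSet → FSet → ℕ → Bool
generatedProp A₁ A₂ p = A₁ (prop p) ∧ A₂ (prop p)

generatedReq : FSet → FSet → Formula → Bool
generatedReq A₁ A₂ ψ = A₁ (⟨D⟩ ψ) ∨ᵇ A₂ (⟨D⟩ ψ) ∨ᵇ A₁ ψ ∨ᵇ A₂ ψ

generatedAtom : Formula → FSet → FSet → FSet
generatedAtom φ A₁ A₂ = restrictCL φ (eval (generatedProp A₁ A₂) (generatedReq A₁ A₂))

module _ {φ : Formula} {A₁ A₂ : FSet} where

  generatedReq-⇔ : ∀ {ψ} → ψ ∈REQ φ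
                 → generatedReq A₁ A₂ ψ ≡ true ⇔ (ψ ∈Req A₁ ⊎ ψ ∈Req A₂ ⊎ Obs φ A₁ ψ ⊎ Obs φ A₂ ψ)
  generatedReq-⇔ {ψ} r =
    ⇔.trans (∨-≡-true (A₁ (⟨D⟩ ψ))) (⇔.refl ⊎-⇔
    ⇔.trans (∨-≡-true (A₂ (⟨D⟩ ψ))) (⇔.refl ⊎-⇔
    ⇔.trans (∨-≡-true (A₁ ψ))       (obs {A₁} ⊎-⇔ obs {A₂})))
    where
    obs : ∀ {A} → ψ ∈ A ⇔ Obs φ A ψ
    obs = mk⇔ (_, r) proj₁

  Generated-prop : ∀ {B} → Generated φ A₁ A₂ B → ∀ p → B (prop p) ≡ generatedProp A₁ A₂ p
  Generated-prop g p = ⇔→≡ (⇔.trans (Generated.props g p) (⇔.sym (∧-≡-true (A₁ (prop p)))))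

  Generated-req : ∀ {B} → Generated φ A₁ A₂ B → ∀ ψ → ψ ∈REQ φ → B (⟨D⟩ ψ) ≡ generatedReq A₁ A₂ ψ
  Generated-req g ψ r = ⇔→≡ (⇔.trans (Generated.reqs g ψ) (⇔.sym (generatedReq-⇔ r)))

  generatedAtom-Generated : IsAtom φ A₁ → IsAtom φ A₂ → Generated φ A₁ A₂ (generatedAtom φ A₁ A₂)
  generatedAtom-Generated A₁-atom A₂-atom = record
    { props = λ p → ⇔.trans (restrictCL-⇔ φ)
        (mk⇔ (to (∧-≡-true (A₁ (prop p))) ∘ proj₂)
             (λ m → IsAtom.sub A₁-atom _ (proj₁ m) , from (∧-≡-true (A₁ (prop p))) m))
    ; reqs  = λ ψ → ⇔.trans (restrictCL-⇔ φ)
        (mk⇔ (λ (r , m) → to (generatedReq-⇔ r) m)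
             (λ m → let r = required-∈CL m in r , from (generatedReq-⇔ r) m))
    }
    where
    required-∈CL : ∀ {ψ} → ψ ∈Req A₁ ⊎ ψ ∈Req A₂ ⊎ Obs φ A₁ ψ ⊎ Obs φ A₂ ψ → ψ ∈REQ φ
    required-∈CL (inj₁ ψ∈Req₁)             = IsAtom.sub A₁-atom _ ψ∈Req₁
    required-∈CL (inj₂ (inj₁ ψ∈Req₂))      = IsAtom.sub A₂-atom _ ψ∈Req₂
    required-∈CL (inj₂ (inj₂ (inj₁ (_ , r)))) = r
    required-∈CL (inj₂ (inj₂ (inj₂ (_ , r)))) = r

lemma3p2 : ∀ (φ : Formula) (A₁ A₂ : FSet) → IsAtom φ A₁ → IsAtom φ A₂
    → Σ FSet (λ A₃ → (IsAtom φ A₃ × Generated φ A₁ A₂ A₃)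
        × (∀ (B : FSet) → IsAtom φ B → Generated φ A₁ A₂ B → ∀ ψ → B ψ ≡ A₃ ψ))
lemma3p2 φ A₁ A₂ A₁-atom A₂-atom =
  generatedAtom φ A₁ A₂ ,
  (restrictCL-isAtom φ (λ _ → refl) (λ _ _ → refl) , generatedAtom-Generated A₁-atom A₂-atom) ,
  λ B B-atom B-gen → atom-determined B-atom (λ p _ → Generated-prop B-gen p) (Generated-req B-gen)
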